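{- The calculus $\mathbf{L}^{\Lambda}_{\backslash,/}\wedge\mathbf{0}\mathbf{1}$ is strongly sound with respect to the class of product-free non-standard square R-models: for every set $\mathcal{H}$ of product-free sequents and every product-free sequent $\Pi\to B$, if $\Pi\to B$ is derivable from $\mathcal{H}$ in $\mathbf{L}^{\Lambda}_{\backslash,/}\wedge\mathbf{0}\mathbf{1}$, then $\Pi\to B$ is true in every product-free non-standard square R-model in which all sequents of $\mathcal{H}$ are true.
   Context: Product-free formulae are built from a countable set of propositional variables and the constants $\mathbf{0}$ and $\mathbf{1}$ using the binary connectives $\backslash$, $/$, $\wedge$. A sequent is $\Pi \to B$ with $B$ a formula and $\Pi$ a finite, possibly empty, sequence of formulae (empty sequence written $\Lambda$). The calculus $\mathbf{L}^{\Lambda}_{\backslash,/}\wedge\mathbf{0}\mathbf{1}$ has axioms $A \to A$, $\Gamma,\mathbf{0},\Delta \to C$, $\Lambda \to \mathbf{1}$ and rules (capital Greek letters denote possibly empty sequences): (Cut) from $\Pi \to A$ and $\Gamma, A, \Delta \to C$ infer $\Gamma,\Pi,\Delta\to C$; ($\backslash L$) from $\Pi\to A$ and $\Gamma,B,\Delta\to C$ infer $\Gamma,\Pi,A\backslash B,\Delta\to C$; ($\backslash R$) from $A,\Pi\to B$ infer $\Pi\to A\backslash B$; ($/ L$) from $\Pi\to A$ and $\Gamma,B,\Delta\to C$ infer $\Gamma,B/A,\Pi,\Delta\to C$; ($/R$) from $\Pi,A\to B$ infer $\Pi\to B/A$; ($\wedge L$) from $\Gamma,A,\Delta\to C$ infer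 both $\Gamma,A\wedge B,\Delta\to C$ and $\Gamma,B\wedge A,\Delta\to C$; ($\wedge R$) from $\Pi\to A$ and $\Pi\to B$ infer $\Pi\to A\wedge B$; ($\mathbf{1} L$) from $\Gamma,\Delta\to C$ infer $\Gamma,\mathbf{1},\Delta\to C$. A sequent is derivable from a set of sequents $\mathcal H$ if it is derivable when the sequents of $\mathcal H$ are added as extra axioms. For binary relations $R,S$ on a non-empty set $W$: $R\circ S=\{(x,z) \mid \exists y\,((x,y)\in R, (y,z)\in S)\}$; $R\backslash S=\{(y,z)\in W\times W \mid \forall x\,((x,y)\in R\Rightarrow (x,z)\in S)\}$; $S/R=\{(x,y)\in W\times W \mid \forall z\,((y,z)\in R\Rightarrow(x,z)\in S)\}$; $\delta=\{(x,x)\mid x\in W\}$. A product-free non-standard square R-model is a tuple $(W,\mathfrak{A},\mathbf{1}_{\mathfrak{A}},\mathbf{0}_{\mathfrak{A}},v)$ where $W$ is non-empty; $\mathfrak{A}$ is a family of binary relations on $W$ closed under $\backslash,/,\cap$ (not necessarily under $\circ$); $\mathbf{1}_{\mathfrak{A}}\in\mathfrak{A}$ satisfies $\mathbf{1}_{\mathfrak{A}}\circ R=R\circ\mathbf{1}_{\mathfrak{A}}=R$ for all $R\in\mathfrak{A}$; $\mathbf{0}_{\mathfrak{A}}\in\mathfrak{A}$ satisfies $\mathbf{0}_{\mathfrak{A}}\subseteq R$ for all $R\in\mathfrak{A}$; and $v$ maps every product-free formula to a member of $\mathfrak{A}$ with $v(A\backslash B)=v(A)\backslash v(B)$, $v(B/A)=v(B)/v(A)$,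 $v(A\wedge B)=v(A)\cap v(B)$, $v(\mathbf{1})=\mathbf{1}_{\mathfrak{A}}$, $v(\mathbf{0})=\mathbf{0}_{\mathfrak{A}}$. A sequent $A_1,\ldots,A_n\to B$ ($n\ge1$) is true in the model if $v(A_1)\circ\cdots\circ v(A_n)\subseteq v(B)$, and $\Lambda\to B$ is true if $\delta\subseteq v(B)$. -}

module Defs where

open import Level using (Level; _⊔_) renaming (suc to lsuc; zero to lzero)
open import Data.Nat using (ℕ)
open import Data.List using (List; []; _∷_; _++_; [_])
open import Data.Product using (Σ; ∃; _×_; _,_)
open import Relation.Binary.PropositionalEquality using (_≡_)

data Formula : Set where
  var  : ℕ → Formula
  𝟎 𝟏  : Formula
  _⧹_  : Formula → Formula → Formula
  _⧸_  : Formula → Formula → Formula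
  _∧_  : Formula → Formula → Formula

infixr 6 _⧹_
infixl 6 _⧸_
infixl 7 _∧_

record Sequent : Set where
  constructor _⇒_
  field
    ant : List Formula
    suc : Formula
infix 4 _⇒_

SequentSet : Set₁
SequentSet = Sequent → Set

data _⊢_ (H : SequentSet) : Sequent → Set where
  hyp  : ∀ {s} → H s → H ⊢ s
  ax   : ∀ {A} → H ⊢ ([ A ] ⇒ A)
  ax0  : ∀ {Γ Δ C} → H ⊢ ((Γ ++ 𝟎 ∷ Δ) ⇒ C)
  ax1  : H ⊢ ([] ⇒ 𝟏)
  cut  : ∀ {Π A Γ Δ C} → H ⊢ (Π ⇒ A) → H ⊢ ((Γ ++ A ∷ Δ) ⇒ C)
       → H ⊢ ((Γ ++ Π ++ Δ) ⇒ C)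
  ⧹L   : ∀ {Π A Γ B Δ C} → H ⊢ (Π ⇒ A) → H ⊢ ((Γ ++ B ∷ Δ) ⇒ C)
       → H ⊢ ((Γ ++ Π ++ (A ⧹ B) ∷ Δ) ⇒ C)
  ⧹R   : ∀ {A Π B} → H ⊢ ((A ∷ Π) ⇒ B) → H ⊢ (Π ⇒ (A ⧹ B))
  ⧸L   : ∀ {Π A Γ B Δ C} → H ⊢ (Π ⇒ A) → H ⊢ ((Γ ++ B ∷ Δ) ⇒ C)
       → H ⊢ ((Γ ++ (B ⧸ A) ∷ Π ++ Δ) ⇒ C)
  ⧸R   : ∀ {Π A B} → H ⊢ ((Π ++ [ A ]) ⇒ B) → H ⊢ (Π ⇒ (B ⧸ A))
  ∧L₁  : ∀ {Γ A B Δ C} → H ⊢ ((Γ ++ A ∷ Δ) ⇒ C) → H ⊢ ((Γ ++ (A ∧ B) ∷ Δ) ⇒ C)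
  ∧L₂  : ∀ {Γ A B Δ C} → H ⊢ ((Γ ++ A ∷ Δ) ⇒ C) → H ⊢ ((Γ ++ (B ∧ A) ∷ Δ) ⇒ C)
  ∧R   : ∀ {Π A B} → H ⊢ (Π ⇒ A) → H ⊢ (Π ⇒ B) → H ⊢ (Π ⇒ (A ∧ B))
  𝟏L   : ∀ {Γ Δ C} → H ⊢ ((Γ ++ Δ) ⇒ C) → H ⊢ ((Γ ++ 𝟏 ∷ Δ) ⇒ C)

Rel : Set → Set₁
Rel W = W → W → Set

module _ {W : Set} where

  _⊆ᵣ_ : Rel W → Rel W → Set
  R ⊆ᵣ S = ∀ x y → R x y → S x y

  _≐_ : Rel W → Rel W → Set
  R ≐ S = (R ⊆ᵣ S) × (S ⊆ᵣ R)

  _∘ᵣ_ : Rel W → Rel W → Rel W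
  (R ∘ᵣ S) x z = ∃ λ y → R x y × S y z

  _⧹ᵣ_ : Rel W → Rel W → Rel W
  (R ⧹ᵣ S) y z = ∀ x → R x y → S x z

  _/ᵣ_ : Rel W → Rel W → Rel W
  (S /ᵣ R) x y = ∀ z → R y z → S x z

  _∩ᵣ_ : Rel W → Rel W → Rel W
  (R ∩ᵣ S) x y = R x y × S x y

  δ : Rel W
  δ x y = x ≡ y

record RModel : Set₂ where
  field
    W     : Set
    w₀    : W                                  -- W is non-empty
    𝔄     : Rel W → Set₁
    𝔄-ext : ∀ {R S} → R ≐ S → 𝔄 R → 𝔄 S       -- 𝔄 is a set of relations (extensional)
    ⧹-cl  : ∀ {R S} → 𝔄 R → 𝔄 S → 𝔄 (R ⧹ᵣ S)
    ⧸-cl  : ∀ {R S} → 𝔄 R → 𝔄 S → 𝔄 (S /ᵣ R)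
    ∩-cl  : ∀ {R S} → 𝔄 R → 𝔄 S → 𝔄 (R ∩ᵣ S)
    𝟏𝔄    : Rel W
    𝟏𝔄∈   : 𝔄 𝟏𝔄
    𝟏-unitˡ : ∀ R → 𝔄 R → (𝟏𝔄 ∘ᵣ R) ≐ R
    𝟏-unitʳ : ∀ R → 𝔄 R → (R ∘ᵣ 𝟏𝔄) ≐ R
    𝟎𝔄    : Rel W
    𝟎𝔄∈   : 𝔄 𝟎𝔄
    𝟎-least : ∀ R → 𝔄 R → 𝟎𝔄 ⊆ᵣ R
    val   : ℕ → Rel W
    val∈  : ∀ p → 𝔄 (val p)

  v : Formula → Rel W
  v (var p) = val p
  v 𝟎       = 𝟎𝔄
  v 𝟏       = 𝟏𝔄
  v (A ⧹ B) = v A ⧹ᵣ v B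
  v (B ⧸ A) = v B /ᵣ v A
  v (A ∧ B) = v A ∩ᵣ v B

  compose : Formula → List Formula → Rel W
  compose A []       = v A
  compose A (B ∷ Bs) = compose' (v A) B Bs
    where
    compose' : Rel W → Formula → List Formula → Rel W
    compose' R B []        = R ∘ᵣ v B
    compose' R B (C ∷ Cs)  = compose' (R ∘ᵣ v B) C Cs

  True : Sequent → Set
  True ([] ⇒ B)      = δ ⊆ᵣ v B
  True ((A ∷ Π) ⇒ B) = compose A Π ⊆ᵣ v B

-- Every left rule then rests on residuation: Γ , Π , Δ ⇒ C is true iff the composite
-- of Π is included in the value of the single formula (Γ ⧹ C) ⧸ Δ. Since v(𝟎) and v(𝟏) only enjoy
-- their defining properties relative to members of 𝔄, it matters that this formula is interpreted
-- in 𝔄: 𝟎 is below it, and 𝟏 is below every member of 𝔄 containing the diagonal.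
module Submission where

open import Defs
open import Data.List using (List; []; _∷_; _++_; [_])
open import Data.Product using (_,_; proj₁; proj₂)
open import Relation.Binary.PropositionalEquality using (_≡_; refl)

module _ {W : Set} where

  ⊆ᵣ-trans : {R S T : Rel W} → R ⊆ᵣ S → S ⊆ᵣ T → R ⊆ᵣ T
  ⊆ᵣ-trans R⊆S S⊆T x y r = S⊆T x y (R⊆S x y r)

  ∘-monoʳ : {R S T : Rel W} → S ⊆ᵣ T → (R ∘ᵣ S) ⊆ᵣ (R ∘ᵣ T)
  ∘-monoʳ S⊆T x z (y , r , s) = y , r , S⊆T y z s

  /-monoˡ : {R S T : Rel W} → R ⊆ᵣ S → (R /ᵣ T) ⊆ᵣ (S /ᵣ T)
  /-monoˡ R⊆S x y r z t = R⊆S x z (r z t)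

  ∘-identityʳ : (R : Rel W) → (R ∘ᵣ δ) ≐ R
  ∘-identityʳ R = (λ { x y (.y , r , refl) → r }) , (λ x y r → y , r , refl)

  ∘-residual⁻ : (R S T U : Rel W) → (R ∘ᵣ (S ∘ᵣ T)) ⊆ᵣ U → S ⊆ᵣ ((R ⧹ᵣ U) /ᵣ T)
  ∘-residual⁻ R S T U h y z s w t x r = h x w (y , r , z , s , t)

  ∘-residual⁺ : (R S T U : Rel W) → S ⊆ᵣ ((R ⧹ᵣ U) /ᵣ T) → (R ∘ᵣ (S ∘ᵣ T)) ⊆ᵣ U
  ∘-residual⁺ R S T U h x w (y , r , z , s , t) = h y z s w t x r

infixr 7 _⧹*_
infixl 6 _⧸*_

_⧹*_ : List Formula → Formula → Formula
[] ⧹* C      = C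
(G ∷ Γ) ⧹* C = Γ ⧹* (G ⧹ C)

_⧸*_ : Formula → List Formula → Formula
C ⧸* []      = C
C ⧸* (D ∷ Δ) = (C ⧸* Δ) ⧸ D

module Semantics (M : RModel) where
  open RModel M

  v* : List Formula → Rel W
  v* []      = δ
  v* (A ∷ Γ) = v A ∘ᵣ v* Γ

  Holds : Sequent → Set
  Holds (Π ⇒ B) = v* Π ⊆ᵣ v B

  v∈𝔄 : ∀ A → 𝔄 (v A)
  v∈𝔄 (var p) = val∈ p
  v∈𝔄 𝟎       = 𝟎𝔄∈
  v∈𝔄 𝟏       = 𝟏𝔄∈
  v∈𝔄 (A ⧹ B) = ⧹-cl (v∈𝔄 A) (v∈𝔄 B)
  v∈𝔄 (B ⧸ A) = ⧸-cl (v∈𝔄 A) (v∈𝔄 B)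
  v∈𝔄 (A ∧ B) = ∩-cl (v∈𝔄 A) (v∈𝔄 B)

  -- The identity relation lies in 𝟏𝔄 ⧹ᵣ 𝟏𝔄, so the left unit law factors it through 𝟏𝔄.
  δ⊆𝟏𝔄 : δ ⊆ᵣ 𝟏𝔄
  δ⊆𝟏𝔄 x .x refl with proj₂ (𝟏-unitˡ (𝟏𝔄 ⧹ᵣ 𝟏𝔄) (⧹-cl 𝟏𝔄∈ 𝟏𝔄∈)) x x (λ _ u → u)
  ... | y , u , u⧹u = u⧹u x u

  𝟏𝔄⊆ : ∀ {R} → 𝔄 R → δ ⊆ᵣ R → 𝟏𝔄 ⊆ᵣ R
  𝟏𝔄⊆ {R} R∈𝔄 δ⊆R y z u = proj₁ (𝟏-unitˡ R R∈𝔄) y z (z , u , δ⊆R z z refl)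

  v*-[_] : ∀ A → v* [ A ] ≐ v A
  v*-[ A ] = ∘-identityʳ (v A)

  v*-++ : ∀ Γ Δ → v* (Γ ++ Δ) ≐ (v* Γ ∘ᵣ v* Δ)
  v*-++ []      Δ = (λ x y p → x , refl , p) , (λ { x y (.x , refl , p) → p })
  v*-++ (G ∷ Γ) Δ =
    (λ { x y (a , g , p) → let z , γ , q = proj₁ (v*-++ Γ Δ) a y p in z , (a , g , γ) , q })
    , (λ { x y (z , (a , g , γ) , q) → a , g , proj₂ (v*-++ Γ Δ) a y (z , γ , q) })

  v*-++-++ : ∀ Γ Π Δ → v* (Γ ++ Π ++ Δ) ≐ (v* Γ ∘ᵣ (v* Π ∘ᵣ v* Δ))
  v*-++-++ Γ Π Δ = ⊆ᵣ-trans (proj₁ (v*-++ Γ _)) (∘-monoʳ (proj₁ (v*-++ Π Δ)))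
                 , ⊆ᵣ-trans (∘-monoʳ (proj₂ (v*-++ Π Δ))) (proj₂ (v*-++ Γ _))

  v-⧹* : ∀ Γ C → v (Γ ⧹* C) ≐ (v* Γ ⧹ᵣ v C)
  v-⧹* []      C = (λ { y z c .y refl → c }) , (λ y z h → h y refl)
  v-⧹* (G ∷ Γ) C =
    (λ { y z p x (a , g , γ) → proj₁ (v-⧹* Γ (G ⧹ C)) y z p a γ x g })
    , (λ y z h → proj₂ (v-⧹* Γ (G ⧹ C)) y z (λ a γ x g → h x (a , g , γ)))

  v-⧸* : ∀ C Δ → v (C ⧸* Δ) ≐ (v C /ᵣ v* Δ)
  v-⧸* C []      = (λ { x y c .y refl → c }) , (λ x y h → h y refl)
  v-⧸* C (D ∷ Δ) =
    (λ { x y p w (z , d , η) → proj₁ (v-⧸* C Δ) x z (p z d) w η })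
    , (λ x y h z d → proj₂ (v-⧸* C Δ) x z (λ w η → h w (z , d , η)))

  v-residual : ∀ Γ C Δ → v (Γ ⧹* C ⧸* Δ) ≐ ((v* Γ ⧹ᵣ v C) /ᵣ v* Δ)
  v-residual Γ C Δ = ⊆ᵣ-trans (proj₁ (v-⧸* _ Δ)) (/-monoˡ (proj₁ (v-⧹* Γ C)))
                   , ⊆ᵣ-trans (/-monoˡ (proj₂ (v-⧹* Γ C))) (proj₂ (v-⧸* _ Δ))

  residuate : ∀ Γ Π Δ C → Holds (Γ ++ Π ++ Δ ⇒ C) → v* Π ⊆ᵣ v (Γ ⧹* C ⧸* Δ)
  residuate Γ Π Δ C h =
    ⊆ᵣ-trans (∘-residual⁻ (v* Γ) (v* Π) (v* Δ) (v C) (⊆ᵣ-trans (proj₂ (v*-++-++ Γ Π Δ)) h))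
             (proj₂ (v-residual Γ C Δ))

  unresiduate : ∀ Γ Π Δ C → v* Π ⊆ᵣ v (Γ ⧹* C ⧸* Δ) → Holds (Γ ++ Π ++ Δ ⇒ C)
  unresiduate Γ Π Δ C h =
    ⊆ᵣ-trans (proj₁ (v*-++-++ Γ Π Δ))
             (∘-residual⁺ (v* Γ) (v* Π) (v* Δ) (v C) (⊆ᵣ-trans h (proj₁ (v-residual Γ C Δ))))

  residuate₁ : ∀ Γ B Δ C → Holds (Γ ++ B ∷ Δ ⇒ C) → v B ⊆ᵣ v (Γ ⧹* C ⧸* Δ)
  residuate₁ Γ B Δ C h = ⊆ᵣ-trans (proj₂ v*-[ B ]) (residuate Γ [ B ] Δ C h)

  unresiduate₁ : ∀ Γ B Δ C → v B ⊆ᵣ v (Γ ⧹* C ⧸* Δ) → Holds (Γ ++ B ∷ Δ ⇒ C)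
  unresiduate₁ Γ B Δ C h = unresiduate Γ [ B ] Δ C (⊆ᵣ-trans (proj₁ v*-[ B ]) h)

  -- `compose` folds its tail with a helper local to a where-block, which cannot be named; this
  -- meta is solved to that helper by the with-abstraction in compose-∷.
  mutual
    compose-tail : Formula → Rel W → Formula → List Formula → Rel W
    compose-tail = _

    compose-∷ : ∀ A B Bs → compose A (B ∷ Bs) ≡ compose-tail A (v A) B Bs
    compose-∷ A B Bs with v A
    ... | R = refl

  compose-tail-≐ : ∀ A R B Bs → compose-tail A R B Bs ≐ (R ∘ᵣ v* (B ∷ Bs))
  compose-tail-≐ A R B [] = (λ { x y (z , r , b) → z , r , y , b , refl })
                          , (λ { x y (z , r , .y , b , refl) → z , r , b })
  compose-tail-≐ A R B (C ∷ Cs) =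
    (λ x y p → let z′ , (z , r , b) , η = proj₁ (compose-tail-≐ A (R ∘ᵣ v B) C Cs) x y p
               in z , r , z′ , b , η)
    , (λ { x y (z , r , z′ , b , η) →
             proj₂ (compose-tail-≐ A (R ∘ᵣ v B) C Cs) x y (z′ , (z , r , b) , η) })

  compose-≐ : ∀ A Π → compose A Π ≐ v* (A ∷ Π)
  compose-≐ A []       = proj₂ v*-[ A ] , proj₁ v*-[ A ]
  compose-≐ A (B ∷ Bs) rewrite compose-∷ A B Bs = compose-tail-≐ A (v A) B Bs

  True⇒Holds : ∀ s → True s → Holds s
  True⇒Holds ([] ⇒ B)      t = t
  True⇒Holds ((A ∷ Π) ⇒ B) t = ⊆ᵣ-trans (proj₂ (compose-≐ A Π)) t

  Holds⇒True : ∀ s → Holds s → True s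
  Holds⇒True ([] ⇒ B)      h = h
  Holds⇒True ((A ∷ Π) ⇒ B) h = ⊆ᵣ-trans (proj₁ (compose-≐ A Π)) h

module Soundness (M : RModel) (H : SequentSet)
                 (H-holds : ∀ h → H h → Semantics.Holds M h) where
  open RModel M
  open Semantics M

  sound : ∀ {s} → H ⊢ s → Holds s
  sound (hyp h) = H-holds _ h
  sound (ax {A}) = proj₁ v*-[ A ]
  sound (ax0 {Γ} {Δ} {C}) = unresiduate₁ Γ 𝟎 Δ C (𝟎-least _ (v∈𝔄 (Γ ⧹* C ⧸* Δ)))
  sound ax1 = δ⊆𝟏𝔄
  sound (cut {Π} {A} {Γ} {Δ} {C} d e) =
    unresiduate Γ Π Δ C (⊆ᵣ-trans (sound d) (residuate₁ Γ A Δ C (sound e)))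
  sound (⧹L {Π} {A} {Γ} {B} {Δ} {C} d e) =
    unresiduate Γ Π ((A ⧹ B) ∷ Δ) C λ y z π z′ a⧹b →
      residuate₁ Γ B Δ C (sound e) y z′ (a⧹b y (sound d y z π))
  sound (⧹R d) y z π x a = sound d x z (y , a , π)
  sound (⧸L {Π} {A} {Γ} {B} {Δ} {C} d e) =
    unresiduate Γ ((B ⧸ A) ∷ Π) Δ C λ { y z (b , b⧸a , π) →
      residuate₁ Γ B Δ C (sound e) y z (b⧸a z (sound d b z π)) }
  sound (⧸R {Π} {A} d) x y π z a =
    sound d x z (proj₂ (v*-++ Π [ A ]) x z (y , π , proj₂ v*-[ A ] y z a))
  sound (∧L₁ {Γ} {A} {B} {Δ} {C} d) =
    unresiduate₁ Γ (A ∧ B) Δ C λ y z ab → residuate₁ Γ A Δ C (sound d) y z (proj₁ ab)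
  sound (∧L₂ {Γ} {A} {B} {Δ} {C} d) =
    unresiduate₁ Γ (B ∧ A) Δ C λ y z ba → residuate₁ Γ A Δ C (sound d) y z (proj₂ ba)
  sound (∧R d e) x y π = sound d x y π , sound e x y π
  sound (𝟏L {Γ} {Δ} {C} d) =
    unresiduate₁ Γ 𝟏 Δ C (𝟏𝔄⊆ (v∈𝔄 (Γ ⧹* C ⧸* Δ)) (residuate Γ [] Δ C (sound d)))

proposition7p3 : (H : SequentSet) (s : Sequent) → H ⊢ s →
    (M : RModel) → (∀ h → H h → RModel.True M h) → RModel.True M s
proposition7p3 H s d M H-true =
  Semantics.Holds⇒True M s (Soundness.sound M H H-holds d)
  where
  H-holds : ∀ h → H h → Semantics.Holds M h
  H-holds h Hh = Semantics.True⇒Holds M h (H-true h Hh)
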